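{- Let $G=(V,E)$ be a finite graph. (1) If $\mathrm{Int}_{es}(G)=\emptyset$, then $v(G)\ge\overline v(G)+l(G)+2e(G)$. (2) If $\mathrm{Int}_s(G)=\emptyset$, then $v(G)=\overline v(G)+l(G)+2e(G)$. In particular, $\overline v(G)=v(G)$ if $G_x$ is not a clique for any vertex $x$ of $G$.
   Context: Graphs are finite and simple; a clique is a set of pairwise adjacent vertices (empty set and singletons included). $v(G)$ is the linear intersection number: the minimum number of points of a linear hypergraph (finite point set, lines are subsets of size $\ge2$, two distinct points in at most one line) whose intersection graph (vertices = lines, adjacent iff distinct and intersecting) is isomorphic to $G$; equivalently the minimum $r$ such that there is a list $C_1,\dots,C_r$ of cliques of $G$ with each edge in exactly one $C_i$ and each vertex in at least two $C_i$. $\overline v(G)$ is the minimum $r$ such that there are cliques $C_1,\dots,C_r$, each of size $\ge2$, with each edge in exactly one $C_i$. $l(G)$ = number of vertices of degree $1$, $e(G)$ = number of isolated vertices. $G_x$ is the neighbourhood of $x$; $x$ is interior if $G_x$ is a clique; $\mathrm{Int}_s(G)$ is the set of interior vertices with $|G_x|>1$. An interior vertex $x$ is extremal if there is a list $C_1,\dots,C_r$ as in the characterization of $v(G)$ with $r=v(G)$ and $G_x\cup\{x\}=C_i$ for some $i$; $\mathrm{Int}_e(G)$ is the set of extremal interior vertices, and $\mathrm{Int}_{es}(G)=\mathrm{Int}_s(G)\cap\mathrm{Int}_e(G)$. -}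

module Defs where

open import Data.Bool using (Bool; true; false; T)
open import Data.Nat using (ℕ; zero; suc; _+_; _≤_; _<_)
open import Data.Fin using (Fin; zero; suc)
open import Data.Fin.Subset using (Subset; _∈_; ∣_∣; ⁅_⁆; _∪_)
open import Data.Vec using (tabulate)
open import Data.Product using (Σ; ∃; _×_; _,_)
open import Relation.Binary.PropositionalEquality using (_≡_; _≢_)
open import Relation.Nullary using (¬_)

record Graph (n : ℕ) : Set where
  field
    adj    : Fin n → Fin n → Bool
    sym    : ∀ x y → adj x y ≡ adj y x
    irrefl : ∀ x → adj x x ≡ false

open Graph public

module _ {n : ℕ} (G : Graph n) where

  Adj : Fin n → Fin n → Set
  Adj x y = T (adj G x y)

  Nb : Fin n → Subset n
  Nb x = tabulate (adj G x)

  deg : Fin n → ℕ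
  deg x = ∣ Nb x ∣

  IsClique : Subset n → Set
  IsClique C = ∀ u w → u ∈ C → w ∈ C → u ≢ w → Adj u w

  EdgeIn : Fin n → Fin n → Subset n → Set
  EdgeIn u w C = u ∈ C × w ∈ C

  EdgesExactlyOnce : {r : ℕ} → (Fin r → Subset n) → Set
  EdgesExactlyOnce {r} Cs =
    ∀ u w → Adj u w →
      Σ (Fin r) λ i → EdgeIn u w (Cs i) × (∀ j → EdgeIn u w (Cs j) → j ≡ i)

  -- a list C_1..C_r as in the characterisation of v(G)
  IsLinCover : (r : ℕ) → (Fin r → Subset n) → Set
  IsLinCover r Cs =
    (∀ i → IsClique (Cs i)) × EdgesExactlyOnce Cs ×
    (∀ x → Σ (Fin r) λ i → Σ (Fin r) λ j → i ≢ j × x ∈ Cs i × x ∈ Cs j)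

  IsEdgeCover : (r : ℕ) → (Fin r → Subset n) → Set
  IsEdgeCover r Cs =
    (∀ i → IsClique (Cs i)) × EdgesExactlyOnce Cs ×
    (∀ i → Σ (Fin n) λ u → Σ (Fin n) λ w → u ≢ w × u ∈ Cs i × w ∈ Cs i)

  IsV : ℕ → Set
  IsV r = (Σ (Fin r → Subset n) (IsLinCover r)) ×
          (∀ s (Cs : Fin s → Subset n) → IsLinCover s Cs → r ≤ s)

  IsVbar : ℕ → Set
  IsVbar r = (Σ (Fin r → Subset n) (IsEdgeCover r)) ×
             (∀ s (Cs : Fin s → Subset n) → IsEdgeCover s Cs → r ≤ s)

  countFin : {m : ℕ} → (Fin m → Bool) → ℕ
  countFin {zero} f = zero
  countFin {suc m} f with f zero
  ... | true  = suc (countFin (λ i → f (suc i)))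
  ... | false = countFin (λ i → f (suc i))

  isEq : ℕ → ℕ → Bool
  isEq zero zero = true
  isEq zero (suc _) = false
  isEq (suc _) zero = false
  isEq (suc a) (suc b) = isEq a b

  l : ℕ
  l = countFin (λ x → isEq (deg x) 1)

  e : ℕ
  e = countFin (λ x → isEq (deg x) 0)

  Interior : Fin n → Set
  Interior x = IsClique (Nb x)

  InIntS : Fin n → Set
  InIntS x = Interior x × 1 < deg x

  -- x is extremal (given that v(G) = r)
  Extremal : ℕ → Fin n → Set
  Extremal r x = Interior x ×
    Σ (Fin r → Subset n) λ Cs → IsLinCover r Cs ×
      Σ (Fin r) λ i → Cs i ≡ ⁅ x ⁆ ∪ Nb x

{-# OPTIONS --safe #-}
module Submission where

-- In a list of cliques realising v(G) (every edge in exactly one member, every vertex in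
-- two), the members with two or more vertices form an edge decomposition, so there are at
-- least v̄(G) of them. A member with at most one vertex determines that vertex; a vertex of
-- degree 1 lies in such a member (two nontrivial members through it would share its only
-- edge), and an isolated vertex lies in two. Hence v(G) ≥ v̄(G) + l(G) + 2e(G) for every
-- graph. Conversely, a vertex with two non-adjacent neighbours lies in two distinct members
-- of any edge decomposition; so if Int_s(G) = ∅, an optimal edge decomposition plus one
-- singleton per leaf and two per isolated vertex realises v(G). If no vertex is interior,
-- there are no leaves or isolated vertices and the edge decomposition itself suffices.

open import Defs hiding (sym)
open import Data.Bool using (Bool; true; false; T)
open import Data.Bool.Properties using (T?; T-≡)
open import Data.Fin using (Fin; zero; suc; splitAt; join; _↑ˡ_; _↑ʳ_; _≟_)
open import Data.Fin.Properties
  using (suc-injective; any?; join-splitAt; splitAt⁻¹-↑ˡ; ↑ˡ-injective; ↑ʳ-injective; injective⇒≤; all?; ¬∀⟶∃¬)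
open import Data.Fin.Subset using (Subset; _∈_; ∣_∣; ⁅_⁆; Nonempty)
open import Data.Fin.Subset.Properties
  using (_∈?_; nonempty?; Empty-unique; ∣⊥∣≡0; x∈⁅y⁆⇒x≡y; x∈⁅y⁆⇔x≡y; x∈p∧x≢y⇒x∈p-y; x∈p⇒∣p-x∣<∣p∣)
open import Data.Nat using (ℕ; zero; suc; _+_; _*_; _≤_; _<_; z≤n; s≤s)
open import Data.Nat.Properties using (≤-<-trans; <-irrefl; ≤-trans; ≤-antisym; m≤m+n; +-monoˡ-≤)
open import Data.Product using (∃; ∃₂; _×_; _,_; proj₁; proj₂)
open import Data.Sum using (inj₁; inj₂; [_,_]′)
open import Data.Vec.Properties using (lookup∘tabulate; []=⇒lookup; lookup⇒[]=)
open import Data.Vec.Functional using (Vector; []; _++_)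
open import Data.Vec.Functional.Properties using (lookup-++ˡ; lookup-++ʳ)
import Data.Vec.Functional.Relation.Unary.All.Properties as All
open import Function using (_∘_; Injective; Equivalence)
open import Relation.Binary.PropositionalEquality using (_≡_; _≢_; refl; sym; trans; cong; subst)
open import Relation.Nullary using (¬_; Dec; yes; no; contradiction)
open import Relation.Nullary.Decidable using (_×-dec_; ¬?; isYes; toWitness; fromWitness; decidable-stable)

[,]-injective : ∀ {A B C : Set} {f : A → C} {g : B → C} →
  Injective _≡_ _≡_ f → Injective _≡_ _≡_ g → (∀ a b → f a ≢ g b) →
  Injective _≡_ _≡_ [ f , g ]′
[,]-injective f-inj g-inj f≢g {inj₁ a} {inj₁ a′} eq = cong inj₁ (f-inj eq)
[,]-injective f-inj g-inj f≢g {inj₁ a} {inj₂ b}  eq = contradiction eq (f≢g a b)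
[,]-injective f-inj g-inj f≢g {inj₂ b} {inj₁ a}  eq = contradiction (sym eq) (f≢g a b)
[,]-injective f-inj g-inj f≢g {inj₂ b} {inj₂ b′} eq = cong inj₂ (g-inj eq)

splitAt-injective : ∀ m {k} → Injective _≡_ _≡_ (splitAt m {k})
splitAt-injective m {k} {i} {j} eq =
  trans (sym (join-splitAt m k i)) (trans (cong (join m k) eq) (join-splitAt m k j))

++-injective : ∀ {A : Set} {m k} {xs : Vector A m} {ys : Vector A k} →
  Injective _≡_ _≡_ xs → Injective _≡_ _≡_ ys → (∀ i j → xs i ≢ ys j) →
  Injective _≡_ _≡_ (xs ++ ys)
++-injective {m = m} xs-inj ys-inj xs≢ys eq =
  splitAt-injective m ([,]-injective xs-inj ys-inj xs≢ys eq)

↑ˡ≢↑ʳ : ∀ {m k} (i : Fin m) (j : Fin k) → i ↑ˡ k ≢ m ↑ʳ j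
↑ˡ≢↑ʳ zero    j ()
↑ˡ≢↑ʳ (suc i) j eq = ↑ˡ≢↑ʳ i j (suc-injective eq)

module _ {n : ℕ} where

  x∈p⇒0<∣p∣ : ∀ {p : Subset n} {x} → x ∈ p → 0 < ∣ p ∣
  x∈p⇒0<∣p∣ x∈p = ≤-<-trans z≤n (x∈p⇒∣p-x∣<∣p∣ x∈p)

  x∈p∧y∈p∧x≢y⇒1<∣p∣ : ∀ {p : Subset n} {x y} → x ∈ p → y ∈ p → x ≢ y → 1 < ∣ p ∣
  x∈p∧y∈p∧x≢y⇒1<∣p∣ x∈p y∈p x≢y =
    ≤-<-trans (x∈p⇒0<∣p∣ (x∈p∧x≢y⇒x∈p-y y∈p (x≢y ∘ sym))) (x∈p⇒∣p-x∣<∣p∣ x∈p)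

  0<∣p∣⇒nonempty : ∀ {p : Subset n} → 0 < ∣ p ∣ → Nonempty p
  0<∣p∣⇒nonempty {p} 0<∣p∣ with nonempty? p
  ... | yes p≠∅ = p≠∅
  ... | no  p=∅ =
    contradiction (subst (0 <_) (trans (cong ∣_∣ (Empty-unique p=∅)) (∣⊥∣≡0 n)) 0<∣p∣) λ ()

  Nontrivial : Subset n → Set
  Nontrivial C = ∃₂ λ u w → u ≢ w × u ∈ C × w ∈ C

  nontrivial? : ∀ C → Dec (Nontrivial C)
  nontrivial? C = any? λ u → any? λ w → ¬? (u ≟ w) ×-dec u ∈? C ×-dec w ∈? C

  trivial⇒∈-unique : ∀ {C x y} → ¬ Nontrivial C → x ∈ C → y ∈ C → x ≡ y
  trivial⇒∈-unique {x = x} {y} trivial x∈C y∈C with x ≟ y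
  ... | yes x≡y = x≡y
  ... | no  x≢y = contradiction (x , y , x≢y , x∈C , y∈C) trivial

  nontrivial⇒∃≢ : ∀ {C x} → Nontrivial C → ∃ λ y → y ∈ C × x ≢ y
  nontrivial⇒∃≢ {x = x} (u , w , u≢w , u∈C , w∈C) with x ≟ u
  ... | yes refl = w , w∈C , u≢w
  ... | no  x≢u  = u , u∈C , x≢u

  InTwoMembers : ∀ {r} → Vector (Subset n) r → Fin n → Set
  InTwoMembers {r} Cs x = ∃₂ λ (i j : Fin r) → i ≢ j × x ∈ Cs i × x ∈ Cs j

  module _ {m k} (Cs : Vector (Subset n) m) (Ds : Vector (Subset n) k) {x : Fin n} where

    ∈-++ˡ : ∀ {i} → x ∈ Cs i → x ∈ (Cs ++ Ds) (i ↑ˡ k)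
    ∈-++ˡ {i} = subst (x ∈_) (sym (lookup-++ˡ Cs Ds i))

    ∈-++ʳ : ∀ {j} → x ∈ Ds j → x ∈ (Cs ++ Ds) (m ↑ʳ j)
    ∈-++ʳ {j} = subst (x ∈_) (sym (lookup-++ʳ Cs Ds j))

    inTwo-++ˡ : InTwoMembers Cs x → InTwoMembers (Cs ++ Ds) x
    inTwo-++ˡ (i , j , i≢j , x∈Ci , x∈Cj) =
      i ↑ˡ k , j ↑ˡ k , i≢j ∘ ↑ˡ-injective k i j , ∈-++ˡ x∈Ci , ∈-++ˡ x∈Cj

    inTwo-++ʳ : InTwoMembers Ds x → InTwoMembers (Cs ++ Ds) x
    inTwo-++ʳ (i , j , i≢j , x∈Di , x∈Dj) =
      m ↑ʳ i , m ↑ʳ j , i≢j ∘ ↑ʳ-injective m i j , ∈-++ʳ x∈Di , ∈-++ʳ x∈Dj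

    inTwo-++ : ∀ {i j} → x ∈ Cs i → x ∈ Ds j → InTwoMembers (Cs ++ Ds) x
    inTwo-++ {i} {j} x∈Ci x∈Dj = i ↑ˡ k , m ↑ʳ j , ↑ˡ≢↑ʳ i j , ∈-++ˡ x∈Ci , ∈-++ʳ x∈Dj

module _ {n : ℕ} (G : Graph n) where

  Adj⇒∈Nb : ∀ {x y} → Adj G x y → y ∈ Nb G x
  Adj⇒∈Nb {x} {y} xy =
    lookup⇒[]= y (Nb G x) (trans (lookup∘tabulate (adj G x) y) (Equivalence.to T-≡ xy))

  ∈Nb⇒Adj : ∀ {x y} → y ∈ Nb G x → Adj G x y
  ∈Nb⇒Adj {x} {y} y∈Nb =
    Equivalence.from T-≡ (trans (sym (lookup∘tabulate (adj G x) y)) ([]=⇒lookup y∈Nb))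

  Adj⇒≢ : ∀ {x y} → Adj G x y → x ≢ y
  Adj⇒≢ {x} xx refl = subst T (irrefl G x) xx

  deg≡0⇒¬Adj : ∀ {x y} → deg G x ≡ 0 → ¬ Adj G x y
  deg≡0⇒¬Adj deg≡0 xy = <-irrefl refl (subst (0 <_) deg≡0 (x∈p⇒0<∣p∣ (Adj⇒∈Nb xy)))

  deg≡1⇒∃Adj : ∀ {x} → deg G x ≡ 1 → ∃ (Adj G x)
  deg≡1⇒∃Adj deg≡1 with 0<∣p∣⇒nonempty (subst (0 <_) (sym deg≡1) (s≤s z≤n))
  ... | y , y∈Nb = y , ∈Nb⇒Adj y∈Nb

  deg≡1⇒Adj-unique : ∀ {x y z} → deg G x ≡ 1 → Adj G x y → Adj G x z → y ≡ z
  deg≡1⇒Adj-unique {y = y} {z} deg≡1 xy xz with y ≟ z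
  ... | yes y≡z = y≡z
  ... | no  y≢z = contradiction
    (subst (1 <_) deg≡1 (x∈p∧y∈p∧x≢y⇒1<∣p∣ (Adj⇒∈Nb xy) (Adj⇒∈Nb xz) y≢z)) (<-irrefl refl)

  clique∧nontrivial⇒∃Adj : ∀ {C x} → IsClique G C → Nontrivial C → x ∈ C →
    ∃ λ y → y ∈ C × Adj G x y
  clique∧nontrivial⇒∃Adj {x = x} clique nontrivial x∈C with nontrivial⇒∃≢ nontrivial
  ... | y , y∈C , x≢y = y , y∈C , clique x y x∈C y∈C x≢y

  NonadjacentIn : Subset n → Fin n → Fin n → Set
  NonadjacentIn C u w = u ∈ C × w ∈ C × u ≢ w × ¬ Adj G u w

  nonadjacentIn? : ∀ C u w → Dec (NonadjacentIn C u w)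
  nonadjacentIn? C u w = u ∈? C ×-dec w ∈? C ×-dec ¬? (u ≟ w) ×-dec ¬? (T? (adj G u w))

  ¬clique⇒∃nonadjacent : ∀ {C} → ¬ IsClique G C → ∃₂ (NonadjacentIn C)
  ¬clique⇒∃nonadjacent {C} ¬clique =
    let u , ¬∀w = ¬∀⟶∃¬ n _ (λ u → all? λ w → ¬? (nonadjacentIn? C u w)) ¬∀¬nonadjacent
        w , ¬¬uw = ¬∀⟶∃¬ n _ (λ w → ¬? (nonadjacentIn? C u w)) ¬∀w
    in u , w , decidable-stable (nonadjacentIn? C u w) ¬¬uw
    where
    ¬∀¬nonadjacent : ¬ (∀ u w → ¬ NonadjacentIn C u w)
    ¬∀¬nonadjacent none = ¬clique λ u w u∈C w∈C u≢w →
      decidable-stable (T? (adj G u w)) λ ¬uw → none u w (u∈C , w∈C , u≢w , ¬uw)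

  ¬interior⇒inTwoMembers : ∀ {r} {Cs : Vector (Subset n) r} →
    (∀ i → IsClique G (Cs i)) → EdgesExactlyOnce G Cs →
    ∀ {x} → ¬ Interior G x → InTwoMembers Cs x
  ¬interior⇒inTwoMembers cliques once {x} ¬interior with ¬clique⇒∃nonadjacent ¬interior
  ... | u , w , u∈Nb , w∈Nb , u≢w , ¬uw
    with once x u (∈Nb⇒Adj u∈Nb) | once x w (∈Nb⇒Adj w∈Nb)
  ... | i , (x∈Ci , u∈Ci) , _ | j , (x∈Cj , w∈Cj) , _ = i , j , i≢j , x∈Ci , x∈Cj
    where
    i≢j : i ≢ j
    i≢j refl = ¬uw (cliques i u w u∈Ci w∈Cj u≢w)

  enum : ∀ {m} (f : Fin m → Bool) → Fin (countFin G f) → Fin m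
  enum {suc m} f k with f zero
  ... | false = suc (enum (f ∘ suc) k)
  ... | true with k
  ...   | zero   = zero
  ...   | suc k′ = suc (enum (f ∘ suc) k′)

  enum-true : ∀ {m} (f : Fin m → Bool) k → T (f (enum f k))
  enum-true {suc m} f k with f zero in f0
  ... | false = enum-true (f ∘ suc) k
  ... | true with k
  ...   | zero rewrite f0 = _
  ...   | suc k′ = enum-true (f ∘ suc) k′

  enum-injective : ∀ {m} (f : Fin m → Bool) → Injective _≡_ _≡_ (enum f)
  enum-injective {suc m} f {k} {k′} eq with f zero
  ... | false = enum-injective (f ∘ suc) (suc-injective eq)
  ... | true with k | k′
  ...   | zero  | zero   = refl
  ...   | suc j | suc j′ = cong suc (enum-injective (f ∘ suc) (suc-injective eq))

  enum-surjective : ∀ {m} (f : Fin m → Bool) {i} → T (f i) → ∃ λ k → enum f k ≡ i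
  enum-surjective {suc m} f {zero} fi with f zero
  ... | true = zero , refl
  enum-surjective {suc m} f {suc i} fi with f zero | enum-surjective (f ∘ suc) fi
  ... | true  | k , k↦i = suc k , cong suc k↦i
  ... | false | k , k↦i = k , cong suc k↦i

  isEq-sound : ∀ {a b} → T (isEq G a b) → a ≡ b
  isEq-sound {zero}  {zero}  _ = refl
  isEq-sound {suc a} {suc b} t = cong suc (isEq-sound t)

  isEq-refl : ∀ a → T (isEq G a a)
  isEq-refl zero    = _
  isEq-refl (suc a) = isEq-refl a

  hasDegree : ℕ → Fin n → Bool
  hasDegree d x = isEq G (deg G x) d

  ofDegree : ∀ d → Fin (countFin G (hasDegree d)) → Fin n
  ofDegree d = enum (hasDegree d)

  ofDegree-deg : ∀ d k → deg G (ofDegree d k) ≡ d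
  ofDegree-deg d k = isEq-sound (enum-true (hasDegree d) k)

  ofDegree-injective : ∀ d → Injective _≡_ _≡_ (ofDegree d)
  ofDegree-injective d = enum-injective (hasDegree d)

  ofDegree-surjective : ∀ {d x} → deg G x ≡ d → ∃ λ k → ofDegree d k ≡ x
  ofDegree-surjective {d} {x} deg≡d =
    enum-surjective (hasDegree d) (subst (T ∘ isEq G (deg G x)) deg≡d (isEq-refl (deg G x)))

  leaf : Fin (l G) → Fin n
  leaf = ofDegree 1

  isolated : Fin (e G) → Fin n
  isolated = ofDegree 0

  module LowerBound {s} {Cs : Vector (Subset n) s}
    (cliques : ∀ i → IsClique G (Cs i)) (once : EdgesExactlyOnce G Cs)
    (twice : ∀ x → InTwoMembers Cs x) where

    isNontrivial : Fin s → Bool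
    isNontrivial i = isYes (nontrivial? (Cs i))

    nontrivialMember : Fin (countFin G isNontrivial) → Fin s
    nontrivialMember = enum isNontrivial

    nontrivialMember-nontrivial : ∀ k → Nontrivial (Cs (nontrivialMember k))
    nontrivialMember-nontrivial k = toWitness (enum-true isNontrivial k)

    nontrivialMembers-isEdgeCover : IsEdgeCover G _ (Cs ∘ nontrivialMember)
    nontrivialMembers-isEdgeCover =
      cliques ∘ nontrivialMember , once′ , nontrivialMember-nontrivial
      where
      once′ : EdgesExactlyOnce G (Cs ∘ nontrivialMember)
      once′ u w uw with once u w uw
      ... | i , uw∈Ci , unique
        with enum-surjective isNontrivial (fromWitness (u , w , Adj⇒≢ uw , uw∈Ci))
      ... | k , k↦i = k , subst (EdgeIn G u w ∘ Cs) (sym k↦i) uw∈Ci ,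
                      λ k′ uw∈ → enum-injective isNontrivial (trans (unique _ uw∈) (sym k↦i))

    TrivialAt : Fin n → Fin s → Set
    TrivialAt x i = x ∈ Cs i × ¬ Nontrivial (Cs i)

    trivialAt-unique : ∀ {x y i} → TrivialAt x i → TrivialAt y i → x ≡ y
    trivialAt-unique (x∈Ci , trivial) (y∈Ci , _) = trivial⇒∈-unique trivial x∈Ci y∈Ci

    trivialAt-injective : ∀ {k} {f : Fin k → Fin n} {p : Fin k → Fin s} →
      Injective _≡_ _≡_ f → (∀ a → TrivialAt (f a) (p a)) → Injective _≡_ _≡_ p
    trivialAt-injective {f = f} f-inj p-trivial {a} {b} pa≡pb =
      f-inj (trivialAt-unique (p-trivial a) (subst (TrivialAt (f b)) (sym pa≡pb) (p-trivial b)))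

    TrivialOfDegree : ℕ → Fin s → Set
    TrivialOfDegree d i = ∃ λ x → deg G x ≡ d × TrivialAt x i

    trivialOfDegree-≢ : ∀ {d d′ i j} → d ≢ d′ → TrivialOfDegree d i → TrivialOfDegree d′ j → i ≢ j
    trivialOfDegree-≢ d≢d′ (x , deg≡d , x-trivial) (y , deg≡d′ , y-trivial) refl =
      d≢d′ (trans (sym deg≡d) (trans (cong (deg G) (trivialAt-unique x-trivial y-trivial)) deg≡d′))

    nontrivial⇒≢trivial : ∀ {d i j} → Nontrivial (Cs i) → TrivialOfDegree d j → i ≢ j
    nontrivial⇒≢trivial nontrivial (_ , _ , _ , trivial) refl = trivial nontrivial

    deg≡0⇒trivialAt : ∀ {x i} → deg G x ≡ 0 → x ∈ Cs i → TrivialAt x i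
    deg≡0⇒trivialAt deg≡0 x∈Ci = x∈Ci , λ nontrivial →
      deg≡0⇒¬Adj deg≡0 (proj₂ (proj₂ (clique∧nontrivial⇒∃Adj (cliques _) nontrivial x∈Ci)))

    deg≡1⇒nontrivialMember-unique : ∀ {x i j} → deg G x ≡ 1 → x ∈ Cs i → x ∈ Cs j →
      Nontrivial (Cs i) → Nontrivial (Cs j) → i ≡ j
    deg≡1⇒nontrivialMember-unique {x} {i} {j} deg≡1 x∈Ci x∈Cj nontrivialᵢ nontrivialⱼ
      with clique∧nontrivial⇒∃Adj (cliques i) nontrivialᵢ x∈Ci
         | clique∧nontrivial⇒∃Adj (cliques j) nontrivialⱼ x∈Cj
    ... | y , y∈Ci , xy | z , z∈Cj , xz with once x y xy
    ... | _ , _ , unique =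
      trans (unique i (x∈Ci , y∈Ci))
            (sym (unique j (x∈Cj , subst (_∈ Cs j) (sym (deg≡1⇒Adj-unique deg≡1 xy xz)) z∈Cj)))

    deg≡1⇒∃trivialAt : ∀ {x} → deg G x ≡ 1 → ∃ (TrivialAt x)
    deg≡1⇒∃trivialAt {x} deg≡1 with twice x
    ... | i , j , i≢j , x∈Ci , x∈Cj with nontrivial? (Cs i)
    ...   | no  trivialᵢ    = i , x∈Ci , trivialᵢ
    ...   | yes nontrivialᵢ = j , x∈Cj , λ nontrivialⱼ →
      i≢j (deg≡1⇒nontrivialMember-unique deg≡1 x∈Ci x∈Cj nontrivialᵢ nontrivialⱼ)

    leafMember : Fin (l G) → Fin s
    leafMember a = proj₁ (deg≡1⇒∃trivialAt (ofDegree-deg 1 a))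

    leafMember-trivialAt : ∀ a → TrivialAt (leaf a) (leafMember a)
    leafMember-trivialAt a = proj₂ (deg≡1⇒∃trivialAt (ofDegree-deg 1 a))

    leafMember-trivialOfDegree : ∀ a → TrivialOfDegree 1 (leafMember a)
    leafMember-trivialOfDegree a = leaf a , ofDegree-deg 1 a , leafMember-trivialAt a

    isolatedMember₁ isolatedMember₂ : Fin (e G) → Fin s
    isolatedMember₁ c = proj₁ (twice (isolated c))
    isolatedMember₂ c = proj₁ (proj₂ (twice (isolated c)))

    isolatedMember₁-trivialAt : ∀ c → TrivialAt (isolated c) (isolatedMember₁ c)
    isolatedMember₁-trivialAt c with twice (isolated c)
    ... | _ , _ , _ , x∈Ci , _ = deg≡0⇒trivialAt (ofDegree-deg 0 c) x∈Ci

    isolatedMember₂-trivialAt : ∀ c → TrivialAt (isolated c) (isolatedMember₂ c)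
    isolatedMember₂-trivialAt c with twice (isolated c)
    ... | _ , _ , _ , _ , x∈Cj = deg≡0⇒trivialAt (ofDegree-deg 0 c) x∈Cj

    -- 2 * e G unfolds to e G + (e G + 0), hence the trailing [].
    isolatedMembers : Fin (2 * e G) → Fin s
    isolatedMembers = isolatedMember₁ ++ (isolatedMember₂ ++ [])

    isolatedMembers-trivialOfDegree : ∀ t → TrivialOfDegree 0 (isolatedMembers t)
    isolatedMembers-trivialOfDegree =
      All.++⁺ (TrivialOfDegree 0) (λ c → isolated c , ofDegree-deg 0 c , isolatedMember₁-trivialAt c)
        (All.++⁺ (TrivialOfDegree 0)
          (λ c → isolated c , ofDegree-deg 0 c , isolatedMember₂-trivialAt c) λ ())

    isolatedMember₁≢₂ : ∀ c c′ → isolatedMember₁ c ≢ isolatedMember₂ c′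
    isolatedMember₁≢₂ c c′ eq
      with ofDegree-injective 0 (trivialAt-unique (isolatedMember₁-trivialAt c)
             (subst (TrivialAt (isolated c′)) (sym eq) (isolatedMember₂-trivialAt c′)))
    ... | refl = proj₁ (proj₂ (proj₂ (twice (isolated c)))) eq

    isolatedMembers-injective : Injective _≡_ _≡_ isolatedMembers
    isolatedMembers-injective =
      ++-injective (trivialAt-injective (ofDegree-injective 0) isolatedMember₁-trivialAt)
        (++-injective (trivialAt-injective (ofDegree-injective 0) isolatedMember₂-trivialAt)
          (λ { {()} }) λ _ ())
        λ c → All.++⁺ (isolatedMember₁ c ≢_) (isolatedMember₁≢₂ c) λ ()

    chosenMembers : Fin (countFin G isNontrivial + l G + 2 * e G) → Fin s
    chosenMembers = (nontrivialMember ++ leafMember) ++ isolatedMembers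

    chosenMembers-injective : Injective _≡_ _≡_ chosenMembers
    chosenMembers-injective =
      ++-injective
        (++-injective (enum-injective isNontrivial)
          (trivialAt-injective (ofDegree-injective 1) leafMember-trivialAt)
          λ k a → nontrivial⇒≢trivial (nontrivialMember-nontrivial k) (leafMember-trivialOfDegree a))
        isolatedMembers-injective
        λ t u → All.++⁺ (_≢ isolatedMembers u)
          (λ k → nontrivial⇒≢trivial (nontrivialMember-nontrivial k)
                   (isolatedMembers-trivialOfDegree u))
          (λ a → trivialOfDegree-≢ (λ ()) (leafMember-trivialOfDegree a)
                   (isolatedMembers-trivialOfDegree u))
          t

    vbar+l+2e≤length : ∀ {rb} → IsVbar G rb → rb + l G + 2 * e G ≤ s
    vbar+l+2e≤length (_ , minimal) =
      ≤-trans (+-monoˡ-≤ (2 * e G) (+-monoˡ-≤ (l G) (minimal _ _ nontrivialMembers-isEdgeCover)))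
              (injective⇒≤ chosenMembers-injective)

  singleton-isClique : ∀ v → IsClique G ⁅ v ⁆
  singleton-isClique v u w u∈ w∈ u≢w =
    contradiction (trans (x∈⁅y⁆⇒x≡y v u∈) (sym (x∈⁅y⁆⇒x≡y v w∈))) u≢w

  EdgeFree : Subset n → Set
  EdgeFree D = ∀ u w → Adj G u w → ¬ EdgeIn G u w D

  singleton-edgeFree : ∀ v → EdgeFree ⁅ v ⁆
  singleton-edgeFree v u w uw (u∈ , w∈) =
    Adj⇒≢ uw (trans (x∈⁅y⁆⇒x≡y v u∈) (sym (x∈⁅y⁆⇒x≡y v w∈)))

  ++-edgeFree : ∀ {m k} {Cs : Vector (Subset n) m} {Ds : Vector (Subset n) k} →
    EdgesExactlyOnce G Cs → (∀ j → EdgeFree (Ds j)) → EdgesExactlyOnce G (Cs ++ Ds)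
  ++-edgeFree {m} {k} {Cs} {Ds} once edgeFree u w uw with once u w uw
  ... | i , uw∈Ci , unique =
    i ↑ˡ k , subst (EdgeIn G u w) (sym (lookup-++ˡ Cs Ds i)) uw∈Ci , unique′
    where
    unique′ : ∀ t → EdgeIn G u w ((Cs ++ Ds) t) → t ≡ i ↑ˡ k
    unique′ t uw∈ with splitAt m t in split
    ... | inj₁ i′ = trans (sym (splitAt⁻¹-↑ˡ split)) (cong (_↑ˡ k) (unique i′ uw∈))
    ... | inj₂ j  = contradiction uw∈ (edgeFree j u w uw)

  isolatedSingletons : Vector (Subset n) (2 * e G)
  isolatedSingletons = (⁅_⁆ ∘ isolated) ++ ((⁅_⁆ ∘ isolated) ++ [])

  isolatedSingletons-all : (P : Subset n → Set) → (∀ v → P ⁅ v ⁆) →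
    ∀ t → P (isolatedSingletons t)
  isolatedSingletons-all P P⁅⁆ = All.++⁺ P (P⁅⁆ ∘ isolated) (All.++⁺ P (P⁅⁆ ∘ isolated) λ ())

  leafSingletons : Vector (Subset n) (l G)
  leafSingletons = ⁅_⁆ ∘ leaf

  padded : ∀ {r} → Vector (Subset n) r → Vector (Subset n) (r + l G + 2 * e G)
  padded Cs = (Cs ++ leafSingletons) ++ isolatedSingletons

  padded-isLinCover : ∀ {r} {Cs : Vector (Subset n) r} → (∀ x → ¬ InIntS G x) →
    IsEdgeCover G r Cs → IsLinCover G (r + l G + 2 * e G) (padded Cs)
  padded-isLinCover {Cs = Cs} noIntS (cliques , once , _) =
    All.++⁺ (IsClique G) (All.++⁺ (IsClique G) cliques (λ a → singleton-isClique (leaf a)))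
      (isolatedSingletons-all (IsClique G) singleton-isClique) ,
    ++-edgeFree (++-edgeFree once (λ a → singleton-edgeFree (leaf a)))
      (isolatedSingletons-all EdgeFree singleton-edgeFree) ,
    twice
    where
    ∈⁅_⁆ : ∀ {v x} → v ≡ x → x ∈ ⁅ v ⁆
    ∈⁅ v≡x ⁆ = Equivalence.from x∈⁅y⁆⇔x≡y (sym v≡x)

    twice : ∀ x → InTwoMembers (padded Cs) x
    twice x with deg G x in deg≡
    ... | zero = let c , c↦x = ofDegree-surjective deg≡ in
      inTwo-++ʳ (Cs ++ leafSingletons) isolatedSingletons
        (inTwo-++ (⁅_⁆ ∘ isolated) _ ∈⁅ c↦x ⁆ (∈-++ˡ (⁅_⁆ ∘ isolated) [] ∈⁅ c↦x ⁆))
    ... | suc zero =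
      let a , a↦x = ofDegree-surjective deg≡
          y , xy = deg≡1⇒∃Adj deg≡
          i , (x∈Ci , _) , _ = once x y xy
      in inTwo-++ˡ _ isolatedSingletons (inTwo-++ Cs leafSingletons x∈Ci ∈⁅ a↦x ⁆)
    ... | suc (suc _) =
      inTwo-++ˡ _ isolatedSingletons (inTwo-++ˡ Cs leafSingletons
        (¬interior⇒inTwoMembers cliques once λ interior →
          noIntS x (interior , subst (1 <_) (sym deg≡) (s≤s (s≤s z≤n)))))

  edgeCover⇒linCover : ∀ {r} {Cs : Vector (Subset n) r} → (∀ x → ¬ Interior G x) →
    IsEdgeCover G r Cs → IsLinCover G r Cs
  edgeCover⇒linCover noInterior (cliques , once , _) =
    cliques , once , λ x → ¬interior⇒inTwoMembers cliques once (noInterior x)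

mainTheorem8 : ∀ {n : ℕ} (G : Graph n) (r rb : ℕ) → IsV G r → IsVbar G rb →
    ((∀ x → InIntS G x → ¬ Extremal G r x) → rb + l G + 2 * e G ≤ r)
    × ((∀ x → ¬ InIntS G x) → r ≡ rb + l G + 2 * e G)
    × ((∀ x → ¬ Interior G x) → rb ≡ r)
mainTheorem8 G r rb ((_ , cliques , once , twice) , r-minimal) vbar@((Ds , edgeCover) , _) =
  (λ _ → lower) ,
  (λ noIntS → ≤-antisym (r-minimal _ _ (padded-isLinCover G noIntS edgeCover)) lower) ,
  (λ noInterior → ≤-antisym (≤-trans (≤-trans (m≤m+n rb (l G)) (m≤m+n _ (2 * e G))) lower)
                            (r-minimal rb Ds (edgeCover⇒linCover G noInterior edgeCover)))
  where
  -- The lower bound holds for every graph.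
  lower : rb + l G + 2 * e G ≤ r
  lower = LowerBound.vbar+l+2e≤length G cliques once twice vbar
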